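{- Let \[\mathcal M':=\bigcup_{(k_1,k_2,k_3)\in\mathbb Z_{\ge0}^3}\mathcal M_{k_1,k_2,k_3}\] and let $c_F:=\dfrac{2221564096+283748\sqrt{462}}{491993569}\approx 4.5278295661$ (Freiman's constant). Then \[\mathcal M'\cap[3,c_F)=\big(\mathcal M_{0,0,1}\setminus\{\sqrt5\}\big)\cup\{2\sqrt5\}.\]
   Context: For $(k_1,k_2,k_3)\in\mathbb Z_{\ge0}^3$, the $(k_1,k_2,k_3)$-generalized Markov equation is $x_1^2+x_2^2+x_3^2+k_1x_2x_3+k_2x_3x_1+k_3x_1x_2=(3+k_1+k_2+k_3)x_1x_2x_3$. For $n\in\mathbb Z_{\ge1}$ and $i\in\{1,2,3\}$ put $\Delta(n,i):=((3+k_1+k_2+k_3)n-k_i)^2-4$ (this depends on $(k_1,k_2,k_3)$). The $(k_1,k_2,k_3)$-generalized discrete Markov spectrum is \[\mathcal M_{k_1,k_2,k_3}:=\left\{\frac{\sqrt{\Delta(x_i,i)}}{x_i}\ \middle|\ (x_1,x_2,x_3)\in\mathbb Z_{>0}^3 \text{ solves the }(k_1,k_2,k_3)\text{ -generalized Markov equation},\ i\in\{1,2,3\}\right\}.\] -}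

module Defs where

open import Data.Nat using (ℕ; zero; suc; _+_; _*_; _∸_; _^_; _≤_; _<_)
open import Data.Fin using (Fin; zero; suc)
open import Data.Product using (Σ; ∃; _×_; _,_)
open import Data.Sum using (_⊎_)
open import Relation.Binary.PropositionalEquality using (_≡_)

MarkovEq : (k₁ k₂ k₃ x₁ x₂ x₃ : ℕ) → Set
MarkovEq k₁ k₂ k₃ x₁ x₂ x₃ =
  x₁ ^ 2 + x₂ ^ 2 + x₃ ^ 2 + k₁ * x₂ * x₃ + k₂ * x₃ * x₁ + k₃ * x₁ * x₂
    ≡ (3 + k₁ + k₂ + k₃) * x₁ * x₂ * x₃

pick : Fin 3 → ℕ → ℕ → ℕ → ℕ
pick zero          a b c = a
pick (suc zero)    a b c = b
pick (suc (suc zero)) a b c = c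

-- Δ(n,i) = ((3+k₁+k₂+k₃)n − k_i)² − 4.  For n ≥ 1 we have
-- (3+k₁+k₂+k₃)n − k_i ≥ 3, so truncated subtraction ∸ agrees with
-- integer subtraction in every use below.
Δ : (k₁ k₂ k₃ n : ℕ) → Fin 3 → ℕ
Δ k₁ k₂ k₃ n i = ((3 + k₁ + k₂ + k₃) * n ∸ pick i k₁ k₂ k₃) ^ 2 ∸ 4

-- Every element of a spectrum is of the
-- form √Δ / x, i.e. the nonnegative square root of a rational.  We encode
-- the real number √(N/D) (N, D ∈ ℕ, D > 0) by the pair (N , D).
-- √(N/D) = √Δ(xᵢ,i)/xᵢ  ⟺  N · xᵢ² = Δ(xᵢ,i) · D.

InSpectrum : (k₁ k₂ k₃ N D : ℕ) → Set
InSpectrum k₁ k₂ k₃ N D =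
  Σ ℕ λ x₁ → Σ ℕ λ x₂ → Σ ℕ λ x₃ →
    (0 < x₁) × (0 < x₂) × (0 < x₃) × MarkovEq k₁ k₂ k₃ x₁ x₂ x₃ ×
    Σ (Fin 3) λ i →
      N * (pick i x₁ x₂ x₃) ^ 2 ≡ Δ k₁ k₂ k₃ (pick i x₁ x₂ x₃) i * D

InM' : (N D : ℕ) → Set
InM' N D = Σ ℕ λ k₁ → Σ ℕ λ k₂ → Σ ℕ λ k₃ → InSpectrum k₁ k₂ k₃ N D

-- Freiman's constant c_F = (A + B√462)/C
cF-A cF-B cF-C : ℕ
cF-A = 2221564096
cF-B = 283748
cF-C = 491993569

-- √(N/D) < c_F  ⟺  N/D < c_F² = (A² + 462B² + 2AB√462)/C²
--               ⟺  N C² − D(A² + 462 B²) < 2ABD √462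
--               ⟺  P < Q  or  (Q ≤ P and (P − Q)² < 462 (2ABD)²)
-- where P = N C², Q = D (A² + 462 B²).
LtCF : (N D : ℕ) → Set
LtCF N D =
  (P < Q) ⊎ ((Q ≤ P) × ((P ∸ Q) ^ 2 < 462 * (2 * cF-A * cF-B * D) ^ 2))
  where
    P Q : ℕ
    P = N * cF-C ^ 2
    Q = D * (cF-A ^ 2 + 462 * cF-B ^ 2)

GeThree : (N D : ℕ) → Set
GeThree N D = 9 * D ≤ N

{-# OPTIONS --safe #-}
-- The equation is invariant under rotating k and x simultaneously, so every value can be
-- read at the first coordinate, where Δ = m² − 4 for the root
-- m = (3+k₁+k₂+k₃)x − k₁ = (3+k₂+k₃)x + k₁(x−1).  Since 20 < c_F² < 21, a value in [3, c_F)
-- forces 3x < m < 5x and m² − 4 < 21x².  This leaves x = 1 (value √12), the families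
-- k = (0,0,1), (0,1,0) with m = 4x and k = (1,0,0) with m = 4x − 1, which are values of
-- 𝓜_{0,0,1} up to rotation, and five sporadic pairs (k₁, x): (2,2) gives the value √15 of
-- 𝓜_{0,0,1}, (2,4) gives 2√5, and (1,2), (3,2), (2,3) have no solutions modulo 9, 7, 11.
-- Conversely every value of 𝓜_{0,0,1} other than √5 lies in [3, 4), and 2√5 is attained
-- by the solution (1,1,4) of the (0,0,2)-equation.
module Submission where

open import Defs
open import Data.Nat
open import Data.Nat.Properties
open import Data.Nat.DivMod using (_%_; %-distribˡ-+; %-distribˡ-*; m%n%n≡m%n; m%n<n)
open import Data.Nat.Tactic.RingSolver using (solve; solve-∀)
open import Data.Fin using (zero; suc)
open import Data.List using (_∷_; [])
open import Data.Product using (Σ; ∃-syntax; _×_; _,_)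
open import Data.Sum as Sum using (_⊎_; inj₁; inj₂)
open import Data.Empty using (⊥; ⊥-elim)
open import Relation.Nullary using (¬_; ¬?; Dec)
open import Relation.Nullary.Decidable using (True; toWitness)
open import Relation.Binary.PropositionalEquality
open import Function.Bundles using (_⇔_; mk⇔)

markovLHS markovRHS : (k₁ k₂ k₃ x₁ x₂ x₃ : ℕ) → ℕ
markovLHS k₁ k₂ k₃ x₁ x₂ x₃ = x₁ ^ 2 + x₂ ^ 2 + x₃ ^ 2 + k₁ * x₂ * x₃ + k₂ * x₃ * x₁ + k₃ * x₁ * x₂
markovRHS k₁ k₂ k₃ x₁ x₂ x₃ = (3 + k₁ + k₂ + k₃) * x₁ * x₂ * x₃

MarkovEq-rotate : ∀ k₁ k₂ k₃ x₁ x₂ x₃ → MarkovEq k₁ k₂ k₃ x₁ x₂ x₃ → MarkovEq k₂ k₃ k₁ x₂ x₃ x₁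
MarkovEq-rotate k₁ k₂ k₃ x₁ x₂ x₃ eq = begin
  markovLHS k₂ k₃ k₁ x₂ x₃ x₁
    ≡⟨ rotate-terms (x₁ ^ 2) (x₂ ^ 2) (x₃ ^ 2) (k₁ * x₂ * x₃) (k₂ * x₃ * x₁) (k₃ * x₁ * x₂) ⟩
  markovLHS k₁ k₂ k₃ x₁ x₂ x₃ ≡⟨ eq ⟩
  (3 + k₁ + k₂ + k₃) * x₁ * x₂ * x₃ ≡⟨ solve (k₁ ∷ k₂ ∷ k₃ ∷ x₁ ∷ x₂ ∷ x₃ ∷ []) ⟩
  (3 + k₂ + k₃ + k₁) * x₂ * x₃ * x₁ ∎
  where
  open ≡-Reasoning
  rotate-terms : ∀ a b c u v w → b + c + a + v + w + u ≡ a + b + c + u + v + w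
  rotate-terms = solve-∀

InSpectrum₁ : (k₁ k₂ k₃ N D : ℕ) → Set
InSpectrum₁ k₁ k₂ k₃ N D =
  Σ ℕ λ x₁ → Σ ℕ λ x₂ → Σ ℕ λ x₃ →
    (0 < x₁) × (0 < x₂) × (0 < x₃) × MarkovEq k₁ k₂ k₃ x₁ x₂ x₃ ×
    N * x₁ ^ 2 ≡ Δ k₁ k₂ k₃ x₁ zero * D

markovK-rotate : ∀ k₁ k₂ k₃ → 3 + k₁ + k₂ + k₃ ≡ 3 + k₂ + k₃ + k₁
markovK-rotate = solve-∀

InSpectrum⇒InSpectrum₁ : ∀ {k₁ k₂ k₃ N D} → InSpectrum k₁ k₂ k₃ N D →
  ∃[ j ] ∃[ p ] ∃[ q ] InSpectrum₁ j p q N D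
InSpectrum⇒InSpectrum₁ {k₁} {k₂} {k₃} {N} {D} (x₁ , x₂ , x₃ , x₁>0 , x₂>0 , x₃>0 , eq , zero , h) =
  k₁ , k₂ , k₃ , x₁ , x₂ , x₃ , x₁>0 , x₂>0 , x₃>0 , eq , h
InSpectrum⇒InSpectrum₁ {k₁} {k₂} {k₃} {N} {D} (x₁ , x₂ , x₃ , x₁>0 , x₂>0 , x₃>0 , eq , suc zero , h) =
  k₂ , k₃ , k₁ , x₂ , x₃ , x₁ , x₂>0 , x₃>0 , x₁>0 , MarkovEq-rotate k₁ k₂ k₃ x₁ x₂ x₃ eq ,
  subst (λ K → N * x₂ ^ 2 ≡ ((K * x₂ ∸ k₂) ^ 2 ∸ 4) * D) (markovK-rotate k₁ k₂ k₃) h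
InSpectrum⇒InSpectrum₁ {k₁} {k₂} {k₃} {N} {D} (x₁ , x₂ , x₃ , x₁>0 , x₂>0 , x₃>0 , eq , suc (suc zero) , h) =
  k₃ , k₁ , k₂ , x₃ , x₁ , x₂ , x₃>0 , x₁>0 , x₂>0 ,
  MarkovEq-rotate k₂ k₃ k₁ x₂ x₃ x₁ (MarkovEq-rotate k₁ k₂ k₃ x₁ x₂ x₃ eq) ,
  subst (λ K → N * x₃ ^ 2 ≡ ((K * x₃ ∸ k₃) ^ 2 ∸ 4) * D)
    (trans (markovK-rotate k₁ k₂ k₃) (markovK-rotate k₂ k₃ k₁)) h

module _ {a b c d : ℕ} (ad≡cb : a * d ≡ c * b) .{{_ : NonZero b}} where

  ratio-≤ : ∀ k → k * b ≤ a → k * d ≤ c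
  ratio-≤ k kb≤a = *-cancelʳ-≤ (k * d) c b (begin
    k * d * b ≡⟨ solve (k ∷ b ∷ d ∷ []) ⟩
    k * b * d ≤⟨ *-monoˡ-≤ d kb≤a ⟩
    a * d     ≡⟨ ad≡cb ⟩
    c * b     ∎)
    where open ≤-Reasoning

  ratio-< : ∀ k .{{_ : NonZero d}} → a < k * b → c < k * d
  ratio-< k a<kb = *-cancelʳ-< b c (k * d) (begin-strict
    c * b     ≡⟨ ad≡cb ⟨
    a * d     <⟨ *-monoˡ-< d a<kb ⟩
    k * b * d ≡⟨ solve (k ∷ b ∷ d ∷ []) ⟩
    k * d * b ∎)
    where open ≤-Reasoning

  ratio-≡ : ∀ k → a ≡ k * b → c ≡ k * d
  ratio-≡ k refl = *-cancelʳ-≡ c (k * d) b (begin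
    c * b     ≡⟨ ad≡cb ⟨
    k * b * d ≡⟨ solve (k ∷ b ∷ d ∷ []) ⟩
    k * d * b ∎)
    where open ≡-Reasoning

ratio-trans : ∀ {a b c d e f} → a * d ≡ c * b → c * f ≡ e * d → .{{_ : NonZero d}} → a * f ≡ e * b
ratio-trans {a} {b} {c} {d} {e} {f} ad≡cb cf≡ed = *-cancelʳ-≡ (a * f) (e * b) d (begin
  a * f * d ≡⟨ solve (a ∷ d ∷ f ∷ []) ⟩
  a * d * f ≡⟨ cong (_* f) ad≡cb ⟩
  c * b * f ≡⟨ solve (b ∷ c ∷ f ∷ []) ⟩
  c * f * b ≡⟨ cong (_* b) cf≡ed ⟩
  e * d * b ≡⟨ solve (b ∷ d ∷ e ∷ []) ⟩
  e * b * d ∎)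
  where open ≡-Reasoning

InSpectrum-resp : ∀ {k₁ k₂ k₃ N D N′ D′} → InSpectrum k₁ k₂ k₃ N D → .{{_ : NonZero D}} →
  N * D′ ≡ N′ * D → InSpectrum k₁ k₂ k₃ N′ D′
InSpectrum-resp {k₁} {k₂} {k₃} {N} {D} {N′} {D′}
                (x₁ , x₂ , x₃ , x₁>0 , x₂>0 , x₃>0 , eq , i , h) ND′≡N′D =
  x₁ , x₂ , x₃ , x₁>0 , x₂>0 , x₃>0 , eq , i ,
  ratio-trans {N′} {D′} {N} {D} {Δ k₁ k₂ k₃ (pick i x₁ x₂ x₃) i} {pick i x₁ x₂ x₃ ^ 2}
              (sym ND′≡N′D) h

module Congruence (n : ℕ) .{{_ : NonZero n}} where

  infix 4 _≈_
  record _≈_ (a b : ℕ) : Set where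
    constructor mod≡
    field mod≡⁻¹ : a % n ≡ b % n
  open _≈_

  ≈-refl : ∀ {a} → a ≈ a
  ≈-refl = mod≡ refl

  %-≈ : ∀ a → a % n ≈ a
  %-≈ a = mod≡ (m%n%n≡m%n a n)

  +-cong : ∀ {a a′ b b′} → a ≈ a′ → b ≈ b′ → a + b ≈ a′ + b′
  +-cong {a} {a′} {b} {b′} (mod≡ a≈a′) (mod≡ b≈b′) = mod≡ (begin
    (a + b) % n               ≡⟨ %-distribˡ-+ a b n ⟩
    (a % n + b % n) % n       ≡⟨ cong₂ (λ u v → (u + v) % n) a≈a′ b≈b′ ⟩
    (a′ % n + b′ % n) % n     ≡⟨ %-distribˡ-+ a′ b′ n ⟨
    (a′ + b′) % n             ∎)
    where open ≡-Reasoning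

  *-cong : ∀ {a a′ b b′} → a ≈ a′ → b ≈ b′ → a * b ≈ a′ * b′
  *-cong {a} {a′} {b} {b′} (mod≡ a≈a′) (mod≡ b≈b′) = mod≡ (begin
    (a * b) % n               ≡⟨ %-distribˡ-* a b n ⟩
    (a % n * (b % n)) % n     ≡⟨ cong₂ (λ u v → (u * v) % n) a≈a′ b≈b′ ⟩
    (a′ % n * (b′ % n)) % n   ≡⟨ %-distribˡ-* a′ b′ n ⟨
    (a′ * b′) % n             ∎)
    where open ≡-Reasoning

  ^-cong : ∀ {a b} → a ≈ b → ∀ k → a ^ k ≈ b ^ k
  ^-cong a≈b zero    = ≈-refl
  ^-cong a≈b (suc k) = *-cong a≈b (^-cong a≈b k)

  markovLHS-cong : ∀ k₁ k₂ k₃ x {y y′ z z′} → y ≈ y′ → z ≈ z′ →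
    markovLHS k₁ k₂ k₃ x y z ≈ markovLHS k₁ k₂ k₃ x y′ z′
  markovLHS-cong k₁ k₂ k₃ x y≈ z≈ =
    +-cong (+-cong (+-cong (+-cong (+-cong (≈-refl {x ^ 2}) (^-cong y≈ 2)) (^-cong z≈ 2))
      (*-cong (*-cong (≈-refl {k₁}) y≈) z≈)) (*-cong (*-cong (≈-refl {k₂}) z≈) (≈-refl {x})))
      (*-cong (≈-refl {k₃ * x}) y≈)

  markovRHS-cong : ∀ k₁ k₂ k₃ x {y y′ z z′} → y ≈ y′ → z ≈ z′ →
    markovRHS k₁ k₂ k₃ x y z ≈ markovRHS k₁ k₂ k₃ x y′ z′
  markovRHS-cong k₁ k₂ k₃ x y≈ z≈ = *-cong (*-cong (≈-refl {(3 + k₁ + k₂ + k₃) * x}) y≈) z≈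

  NoSolutionMod : (k₁ k₂ k₃ x : ℕ) → Set
  NoSolutionMod k₁ k₂ k₃ x =
    ∀ {b} → b < n → ∀ {c} → c < n → ¬ markovLHS k₁ k₂ k₃ x b c % n ≡ markovRHS k₁ k₂ k₃ x b c % n

  noSolutionMod? : ∀ k₁ k₂ k₃ x → Dec (NoSolutionMod k₁ k₂ k₃ x)
  noSolutionMod? k₁ k₂ k₃ x = allUpTo? (λ b → allUpTo? (λ c → ¬? (_ ≟ _)) n) n

  MarkovEq-unsolvable : ∀ k₁ k₂ k₃ x → True (noSolutionMod? k₁ k₂ k₃ x) →
    ∀ y z → ¬ MarkovEq k₁ k₂ k₃ x y z
  MarkovEq-unsolvable k₁ k₂ k₃ x none y z eq =
    toWitness none (m%n<n y n) (m%n<n z n) (begin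
      markovLHS k₁ k₂ k₃ x (y % n) (z % n) % n ≡⟨ mod≡⁻¹ (markovLHS-cong k₁ k₂ k₃ x (%-≈ y) (%-≈ z)) ⟩
      markovLHS k₁ k₂ k₃ x y z % n             ≡⟨ cong (_% n) eq ⟩
      markovRHS k₁ k₂ k₃ x y z % n             ≡⟨ mod≡⁻¹ (markovRHS-cong k₁ k₂ k₃ x (%-≈ y) (%-≈ z)) ⟨
      markovRHS k₁ k₂ k₃ x (y % n) (z % n) % n ∎)
    where open ≡-Reasoning

open Congruence using (MarkovEq-unsolvable)

¬MarkovEq-200-3 : ∀ y z → ¬ MarkovEq 2 0 0 3 y z
¬MarkovEq-200-3 = MarkovEq-unsolvable 11 2 0 0 3 _

¬MarkovEq-300-2 : ∀ y z → ¬ MarkovEq 3 0 0 2 y z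
¬MarkovEq-300-2 = MarkovEq-unsolvable 7 3 0 0 2 _

¬MarkovEq-110-2 : ∀ y z → ¬ MarkovEq 1 1 0 2 y z
¬MarkovEq-110-2 = MarkovEq-unsolvable 9 1 1 0 2 _

¬MarkovEq-101-2 : ∀ y z → ¬ MarkovEq 1 0 1 2 y z
¬MarkovEq-101-2 = MarkovEq-unsolvable 9 1 0 1 2 _

n^2≡n*n : ∀ n → n ^ 2 ≡ n * n
n^2≡n*n n = cong (n *_) (*-identityʳ n)

m∸n<o⇒m<n+o : ∀ m n {o} → m ∸ n < o → m < n + o
m∸n<o⇒m<n+o m       zero    m<o = m<o
m∸n<o⇒m<n+o zero    (suc n) _   = z<s
m∸n<o⇒m<n+o (suc m) (suc n) lt  = s<s (m∸n<o⇒m<n+o m n lt)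

<-gap-absurd : ∀ {a b} → a < b → ∀ d → a ≡ b + d → ⊥
<-gap-absurd {b = b} a<b d refl = m+n≮m b d a<b

m*m∸4<n*n : ∀ {m n} .{{_ : NonZero n}} → m ≤ n → m * m ∸ 4 < n * n
m*m∸4<n*n {m} {n} m≤n =
  m<n+o⇒m∸n<o (m * m) 4 {{m*n≢0 n n}} (s≤s (≤-trans (*-mono-≤ m≤n m≤n) (m≤n+m (n * n) 3)))

n*n≤m*m∸4 : ∀ {m n} → 2 ≤ n → n < m → n * n ≤ m * m ∸ 4
n*n≤m*m∸4 {m} {suc (suc n)} (s≤s (s≤s z≤n)) n<m = m+n≤o⇒m≤o∸n (suc (suc n) * suc (suc n)) (begin
  (2 + n) * (2 + n) + 4               ≤⟨ m≤m+n _ (1 + 2 * n) ⟩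
  (2 + n) * (2 + n) + 4 + (1 + 2 * n) ≡⟨ solve (n ∷ []) ⟩
  (3 + n) * (3 + n)                   ≤⟨ *-mono-≤ n<m n<m ⟩
  m * m                               ∎)
  where open ≤-Reasoning

module _ {m x : ℕ} .{{_ : NonZero x}} where

  private
    1≤x*x : 1 ≤ x * x
    1≤x*x = >-nonZero⁻¹ (x * x) {{m*n≢0 x x}}

  3x<m⇒9x²≤m²∸4 : 3 * x < m → 9 * (x * x) ≤ m * m ∸ 4
  3x<m⇒9x²≤m²∸4 3x<m = begin
    9 * (x * x)     ≡⟨ solve (x ∷ []) ⟩
    3 * x * (3 * x) ≤⟨ n*n≤m*m∸4 (≤-trans (n≤1+n 2) (*-monoʳ-≤ 3 (>-nonZero⁻¹ x))) 3x<m ⟩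
    m * m ∸ 4       ∎
    where open ≤-Reasoning

  m≤4x⇒m²∸4<16x² : m ≤ 4 * x → m * m ∸ 4 < 16 * (x * x)
  m≤4x⇒m²∸4<16x² m≤4x = begin-strict
    m * m ∸ 4       <⟨ m*m∸4<n*n {{m*n≢0 4 x}} m≤4x ⟩
    4 * x * (4 * x) ≡⟨ solve (x ∷ []) ⟩
    16 * (x * x)    ∎
    where open ≤-Reasoning

  9x²≤m²∸4⇒3x<m : 9 * (x * x) ≤ m * m ∸ 4 → 3 * x < m
  9x²≤m²∸4⇒3x<m 9x²≤ = ≰⇒> λ m≤3x → <⇒≱ (begin-strict
    m * m ∸ 4       <⟨ m*m∸4<n*n {{m*n≢0 3 x}} m≤3x ⟩
    3 * x * (3 * x) ≡⟨ solve (x ∷ []) ⟩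
    9 * (x * x)     ∎) 9x²≤
    where open ≤-Reasoning

  m²<4+21x²⇒m<5x : m * m < 4 + 21 * (x * x) → m < 5 * x
  m²<4+21x²⇒m<5x m²< = ≰⇒> λ 5x≤m → <⇒≱ m²< (begin
    4 + 21 * (x * x)           ≤⟨ +-monoˡ-≤ (21 * (x * x)) (*-monoʳ-≤ 4 1≤x*x) ⟩
    4 * (x * x) + 21 * (x * x) ≡⟨ solve (x ∷ []) ⟩
    5 * x * (5 * x)            ≤⟨ *-mono-≤ 5x≤m 5x≤m ⟩
    m * m                      ∎)
    where open ≤-Reasoning

-- Indexed by k₁, k₂ + k₃ and x; [a,b] is the sporadic case k₁ = a, x = b.
data Admissible : ℕ → ℕ → ℕ → Set where
  x≡1    : ∀ {j} → Admissible j 1 1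
  m≡4x   : ∀ {t} → Admissible 0 1 (suc t)
  m≡4x∸1 : ∀ {t} → Admissible 1 0 (2 + t)
  [1,2]  : Admissible 1 1 2
  [2,2]  : Admissible 2 0 2
  [2,3]  : Admissible 2 0 3
  [2,4]  : Admissible 2 0 4
  [3,2]  : Admissible 3 0 2

admissible : ∀ j s t → let x = suc t ; m = (3 + s) * x + t * j in
  3 * x < m → m * m < 4 + 21 * (x * x) → Admissible j s x
admissible j s t 3x<m m²< = classify j s t 3x<m (m²<4+21x²⇒m<5x m²<) m²<
  where
  classify : ∀ j s t → let x = suc t ; m = (3 + s) * x + t * j in
    3 * x < m → m < 5 * x → m * m < 4 + 21 * (x * x) → Admissible j s x
  classify j (suc (suc s)) t _ m<5x _ =
    ⊥-elim (<-gap-absurd m<5x (s * suc t + t * j) (solve (j ∷ s ∷ t ∷ [])))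
  classify j 0 zero 3<3 _ _ = ⊥-elim (<-irrefl refl 3<3)
  classify j 1 zero _ _ _ = x≡1
  classify 0 1 (suc t) _ _ _ = m≡4x
  classify 1 1 1 _ _ _ = [1,2]
  classify 1 1 (suc (suc u)) _ _ m²< =
    ⊥-elim (<-gap-absurd m²< (3 + 14 * u + 4 * (u * u)) (solve (u ∷ [])))
  classify (suc (suc j)) 1 (suc u) _ m<5x _ =
    ⊥-elim (<-gap-absurd m<5x (u + j * (1 + u)) (solve (j ∷ u ∷ [])))
  classify 0 0 (suc t) 3x<m _ _ = ⊥-elim (<-gap-absurd 3x<m 0 (solve (t ∷ [])))
  classify 1 0 (suc t) _ _ _ = m≡4x∸1
  classify 2 0 1 _ _ _ = [2,2]
  classify 2 0 2 _ _ _ = [2,3]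
  classify 2 0 3 _ _ _ = [2,4]
  classify 2 0 (suc (suc (suc (suc u)))) _ _ m²< =
    ⊥-elim (<-gap-absurd m²< (20 * u + 4 * (u * u)) (solve (u ∷ [])))
  classify 3 0 1 _ _ _ = [3,2]
  classify 3 0 (suc (suc u)) _ m<5x _ = ⊥-elim (<-gap-absurd m<5x u (solve (u ∷ [])))
  classify (suc (suc (suc (suc j)))) 0 (suc u) _ m<5x _ =
    ⊥-elim (<-gap-absurd m<5x (2 * u + j * (1 + u)) (solve (j ∷ u ∷ [])))

Δ₁≡ : ∀ j p q t → let m = (3 + (p + q)) * suc t + t * j in Δ j p q (suc t) zero ≡ m * m ∸ 4
Δ₁≡ j p q t = begin
  ((3 + j + p + q) * suc t ∸ j) ^ 2 ∸ 4 ≡⟨ cong (λ r → r ^ 2 ∸ 4) root≡ ⟩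
  m ^ 2 ∸ 4                             ≡⟨ cong (_∸ 4) (n^2≡n*n m) ⟩
  m * m ∸ 4                             ∎
  where
  open ≡-Reasoning
  m = (3 + (p + q)) * suc t + t * j
  root≡ : (3 + j + p + q) * suc t ∸ j ≡ m
  root≡ = begin
    (3 + j + p + q) * suc t ∸ j ≡⟨ cong (_∸ j) (expand j p q t) ⟩
    j + m ∸ j                   ≡⟨ m+n∸m≡n j m ⟩
    m                           ∎
    where
    expand : ∀ j p q t → (3 + j + p + q) * suc t ≡ j + ((3 + (p + q)) * suc t + t * j)
    expand = solve-∀

InSpectrum-12 : InSpectrum 0 0 1 12 1
InSpectrum-12 = 1 , 1 , 1 , z<s , z<s , z<s , refl , zero , refl

InSpectrum-20 : InSpectrum 0 0 2 20 1
InSpectrum-20 = 1 , 1 , 4 , z<s , z<s , z<s , refl , suc (suc zero) , refl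

admissible-value : ∀ j p q x y z → 0 < y → 0 < z → MarkovEq j p q x y z → Admissible j (p + q) x →
  InSpectrum 0 0 1 (Δ j p q x zero) (x ^ 2) ⊎ Δ j p q x zero ≡ 20 * x ^ 2
admissible-value j 1 0 1 _ _ _ _ _ x≡1 =
  inj₁ (subst (λ v → InSpectrum 0 0 1 v 1) (sym (Δ₁≡ j 1 0 0)) InSpectrum-12)
admissible-value j 0 1 1 _ _ _ _ _ x≡1 =
  inj₁ (subst (λ v → InSpectrum 0 0 1 v 1) (sym (Δ₁≡ j 0 1 0)) InSpectrum-12)
admissible-value 0 1 0 x@(suc _) y z y>0 z>0 eq m≡4x =
  inj₁ (z , x , y , z>0 , z<s , y>0 ,
        MarkovEq-rotate 1 0 0 y z x (MarkovEq-rotate 0 1 0 x y z eq) , suc zero , refl)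
admissible-value 0 0 1 x@(suc _) y z y>0 z>0 eq m≡4x =
  inj₁ (x , y , z , z<s , y>0 , z>0 , eq , zero , refl)
admissible-value 1 0 0 x@(suc _) y z y>0 z>0 eq m≡4x∸1 =
  inj₁ (y , z , x , y>0 , z>0 , z<s , MarkovEq-rotate 1 0 0 x y z eq , suc (suc zero) , refl)
admissible-value 1 1 0 2 y z _ _ eq [1,2] = ⊥-elim (¬MarkovEq-110-2 y z eq)
admissible-value 1 0 1 2 y z _ _ eq [1,2] = ⊥-elim (¬MarkovEq-101-2 y z eq)
admissible-value 2 0 0 2 _ _ _ _ _ [2,2] = inj₁ (2 , 1 , 1 , z<s , z<s , z<s , refl , zero , refl)
admissible-value 2 0 0 3 y z _ _ eq [2,3] = ⊥-elim (¬MarkovEq-200-3 y z eq)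
admissible-value 2 0 0 4 _ _ _ _ _ [2,4] = inj₂ refl
admissible-value 3 0 0 2 y z _ _ eq [3,2] = ⊥-elim (¬MarkovEq-300-2 y z eq)

InSpectrum₁-window : ∀ {j p q N D} .{{_ : NonZero D}} → InSpectrum₁ j p q N D →
  9 * D ≤ N → N < 21 * D → InSpectrum 0 0 1 N D ⊎ N ≡ 20 * D
InSpectrum₁-window {j} {p} {q} {N} {D} (x@(suc t) , y , z , _ , y>0 , z>0 , eq , N≈Δ) 9D≤N N<21D =
  Sum.map (λ sp → InSpectrum-resp {N = Δ j p q x zero} {N′ = N} sp (sym N≈Δ))
          (ratio-≡ {Δ j p q x zero} {x ^ 2} {N} {D} (sym N≈Δ) 20)
    (admissible-value j p q x y z y>0 z>0 eq (admissible j (p + q) t 3x<m m²<))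
  where
  m = (3 + (p + q)) * x + t * j
  N≈m : N * (x * x) ≡ (m * m ∸ 4) * D
  N≈m = subst₂ (λ X v → N * X ≡ v * D) (n^2≡n*n x) (Δ₁≡ j p q t) N≈Δ
  3x<m : 3 * x < m
  3x<m = 9x²≤m²∸4⇒3x<m {m} {x} (ratio-≤ {N} {D} {m * m ∸ 4} {x * x} N≈m 9 9D≤N)
  m²< : m * m < 4 + 21 * (x * x)
  m²< = m∸n<o⇒m<n+o (m * m) 4 (ratio-< {N} {D} {m * m ∸ 4} {x * x} N≈m 21 N<21D)

root-window : ∀ {N D m x} .{{_ : NonZero D}} .{{_ : NonZero x}} → 3 * x < m → m ≤ 4 * x →
  N * x ^ 2 ≡ (m ^ 2 ∸ 4) * D → 9 * D ≤ N × N < 16 * D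
root-window {N} {D} {m} {x} 3x<m m≤4x N≈ =
  ratio-≤ {m * m ∸ 4} {x * x} {N} {D} ≈N 9 (3x<m⇒9x²≤m²∸4 3x<m) ,
  ratio-< {m * m ∸ 4} {x * x} {N} {D} ≈N 16 (m≤4x⇒m²∸4<16x² m≤4x)
  where
  instance _ = m*n≢0 x x
  ≈N : (m * m ∸ 4) * D ≡ N * (x * x)
  ≈N = sym (subst₂ (λ X v → N * X ≡ (v ∸ 4) * D) (n^2≡n*n x) (n^2≡n*n m) N≈)

3x<4x : ∀ x .{{_ : NonZero x}} → 3 * x < 4 * x
3x<4x x = *-monoˡ-< x (n<1+n 3)

3x<4x∸1 : ∀ x → 2 ≤ x → 3 * x < 4 * x ∸ 1
3x<4x∸1 x@(suc (suc t)) (s≤s (s≤s z≤n)) = m+n≤o⇒m≤o∸n (suc (3 * x)) (begin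
  suc (3 * x) + 1     ≤⟨ m≤m+n _ t ⟩
  suc (3 * x) + 1 + t ≡⟨ solve (t ∷ []) ⟩
  4 * x               ∎)
  where open ≤-Reasoning

InSpectrum001-window : ∀ {N D} .{{_ : NonZero D}} → InSpectrum 0 0 1 N D → ¬ N ≡ 5 * D →
  9 * D ≤ N × N < 16 * D
InSpectrum001-window (x@(suc _) , _ , _ , _ , _ , _ , _ , zero , N≈) _ =
  root-window {x = x} (3x<4x x) ≤-refl N≈
InSpectrum001-window (_ , x@(suc _) , _ , _ , _ , _ , _ , suc zero , N≈) _ =
  root-window {x = x} (3x<4x x) ≤-refl N≈
InSpectrum001-window {N} (_ , _ , 1 , _ , _ , _ , _ , suc (suc zero) , N≈) N≢5D =
  ⊥-elim (N≢5D (trans (sym (*-identityʳ N)) N≈))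
InSpectrum001-window (_ , _ , x@(suc (suc _)) , _ , _ , _ , _ , suc (suc zero) , N≈) _ =
  root-window {x = x} (3x<4x∸1 x (s≤s (s≤s z≤n))) (m∸n≤m (4 * x) 1) N≈

-- c_F² = (Q + K√462)/C², and 462K² ≤ e² says K√462 ≤ e = 21C² − Q.
module Freiman where

  C² Q K e : ℕ
  C² = cF-C ^ 2
  Q  = cF-A ^ 2 + 462 * cF-B ^ 2
  K  = 2 * cF-A * cF-B
  e  = 21 * C² ∸ Q

  20C²<Q : 20 * C² < Q
  20C²<Q = ≤ᵇ⇒≤ _ _ _

  Q≤21C² : Q ≤ 21 * C²
  Q≤21C² = ≤ᵇ⇒≤ _ _ _

  462K²≤e² : 462 * (K * K) ≤ e * e
  462K²≤e² = ≤ᵇ⇒≤ _ _ _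

  N≤20D⇒LtCF : ∀ {N D} .{{_ : NonZero D}} → N ≤ 20 * D → LtCF N D
  N≤20D⇒LtCF {N} {D} N≤20D = inj₁ (begin-strict
    N * C²        ≤⟨ *-monoˡ-≤ C² N≤20D ⟩
    20 * D * C²   ≡⟨ solve (D ∷ []) ⟩
    D * (20 * C²) <⟨ *-monoʳ-< D 20C²<Q ⟩
    D * Q         ∎)
    where open ≤-Reasoning

  LtCF⇒N<21D : ∀ {N D} → LtCF N D → N < 21 * D
  LtCF⇒N<21D {N} {D} N<cF = ≰⇒> λ 21D≤N → Sum.[ P<Q-absurd 21D≤N , gap-absurd 21D≤N ] N<cF
    where
    open ≤-Reasoning
    21DC²≤P : 21 * D ≤ N → D * (21 * C²) ≤ N * C²
    21DC²≤P 21D≤N = begin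
      D * (21 * C²) ≡⟨ solve (D ∷ []) ⟩
      21 * D * C²   ≤⟨ *-monoˡ-≤ C² 21D≤N ⟩
      N * C²        ∎
    P<Q-absurd : 21 * D ≤ N → ¬ N * C² < D * Q
    P<Q-absurd 21D≤N P<Q = <⇒≱ (*-cancelˡ-< D (21 * C²) Q (≤-<-trans (21DC²≤P 21D≤N) P<Q)) Q≤21C²
    gap-absurd : 21 * D ≤ N → ¬ (D * Q ≤ N * C² × (N * C² ∸ D * Q) ^ 2 < 462 * (K * D) ^ 2)
    gap-absurd 21D≤N (_ , gap²<) = <⇒≱ (*-cancelˡ-< (D * D) (e * e) (462 * (K * K)) (begin-strict
      D * D * (e * e)                   ≡⟨ solve (D ∷ []) ⟩
      D * e * (D * e)                   ≡⟨ n^2≡n*n (D * e) ⟨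
      (D * e) ^ 2                       ≤⟨ ^-monoˡ-≤ 2 De≤gap ⟩
      (N * C² ∸ D * Q) ^ 2              <⟨ gap²< ⟩
      462 * (K * D) ^ 2                 ≡⟨ cong (462 *_) (n^2≡n*n (K * D)) ⟩
      462 * (K * D * (K * D))           ≡⟨ solve (D ∷ []) ⟩
      D * D * (462 * (K * K))           ∎)) 462K²≤e²
      where
      De≤gap : D * e ≤ N * C² ∸ D * Q
      De≤gap = begin
        D * e                 ≡⟨ *-distribˡ-∸ D (21 * C²) Q ⟩
        D * (21 * C²) ∸ D * Q ≤⟨ ∸-monoˡ-≤ (D * Q) (21DC²≤P 21D≤N) ⟩
        N * C² ∸ D * Q        ∎

open Freiman using (N≤20D⇒LtCF; LtCF⇒N<21D)

theorem6p10 : (N D : ℕ) → 0 < D →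
    ((InM' N D × GeThree N D × LtCF N D)
      ⇔ ((InSpectrum 0 0 1 N D × ¬ (N ≡ 5 * D)) ⊎ (N ≡ 20 * D)))
theorem6p10 N D 0<D = mk⇔ to from
  where
  instance _ = >-nonZero 0<D

  9D≤N⇒N≢5D : 9 * D ≤ N → ¬ N ≡ 5 * D
  9D≤N⇒N≢5D 9D≤N refl = <⇒≱ (*-monoˡ-< D (≤ᵇ⇒≤ 6 9 _)) 9D≤N

  to : InM' N D × GeThree N D × LtCF N D → (InSpectrum 0 0 1 N D × ¬ N ≡ 5 * D) ⊎ N ≡ 20 * D
  to ((k₁ , k₂ , k₃ , sp) , 9D≤N , N<cF) =
    let j , p , q , sp₁ = InSpectrum⇒InSpectrum₁ {k₁} {k₂} {k₃} {N} {D} sp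
    in Sum.map₁ (_, 9D≤N⇒N≢5D 9D≤N)
         (InSpectrum₁-window {j} {p} {q} {N} {D} sp₁ 9D≤N (LtCF⇒N<21D {N} {D} N<cF))

  from : (InSpectrum 0 0 1 N D × ¬ N ≡ 5 * D) ⊎ N ≡ 20 * D → InM' N D × GeThree N D × LtCF N D
  from (inj₁ (sp , N≢5D)) =
    let 9D≤N , N<16D = InSpectrum001-window {N} {D} sp N≢5D
    in (0 , 0 , 1 , sp) , 9D≤N ,
       N≤20D⇒LtCF {N} {D} (≤-trans (<⇒≤ N<16D) (*-monoˡ-≤ D (≤ᵇ⇒≤ 16 20 _)))
  from (inj₂ refl) =
    (0 , 0 , 2 ,
     InSpectrum-resp {0} {0} {2} {20} {1} {20 * D} {D} InSpectrum-20 (sym (*-identityʳ (20 * D)))) ,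
    *-monoˡ-≤ D (≤ᵇ⇒≤ 9 20 _) , N≤20D⇒LtCF {20 * D} {D} ≤-refl
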